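{- Let $M$ be a uniform matroid on a finite ground set $E$. For every total order $\preceq$ on $E$, the width of each of the BDDs $\mathsf{B}(\mathcal{I}(M))$, $\mathsf{B}(\mathcal{B}(M))$ and ZDDs $\mathsf{Z}(\mathcal{I}(M))$, $\mathsf{Z}(\mathcal{B}(M))$ with respect to $(E,\preceq)$ is at most $\mathrm{pw}(M)+1$.
   Context: $M$ is uniform if its independent sets are the subsets of size at most $r(M)$. $\mathcal{I}(M)$, $\mathcal{B}(M)$ are the collections of independent sets and bases. $r_M$ is the rank function, $\lambda_M(X)=r_M(X)+r_M(E\setminus X)-r_M(E)$, and $\mathrm{pw}(M)=\min_{\preceq}\max_{i\in\{1,\ldots,n\}}\lambda_M(\{e_1,\ldots,e_i\})$ over total orders $e_1\prec\cdots\prec e_n$ of $E$. Decision diagrams: for a total order $\preceq$ and $\mathcal{S}\subseteq 2^E$, the BDD $\mathsf{B}(\mathcal{S})$ (resp. ZDD $\mathsf{Z}(\mathcal{S})$) is obtained from the complete binary decision tree of $\mathcal{S}$ (internal nodes at depth $j$ labeled by the $(j+1)$-th smallest element, each with a 0-arc to $\nu_0$ and 1-arc to $\nu_1$; the leaf reached by taking 1-arcs exactly at elements of $X$ is $\top$ iff $X\in\mathcal{S}$, else $\bot$) by exhaustively: merging non-terminal nodes with the same label and same 0- and 1-successors; and for BDDs removing every non-terminal $\nu$ with $\nu_0=\nu_1$, for ZDDs every non-terminal $\nu$ with $\nu_1=\bot$, redirecting arcs entering $\nu$ to $\nu_0$. If $e_1\prec\cdots\prec e_n$, the $i$-th width ($0\le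 i\le n-1$) is the number of non-terminal nodes labeled $e_{i+1}$; the width is the maximum over $i$. -}

module Defs where

open import Data.Bool using (Bool; true; false; T; _∧_; _∨_; not; if_then_else_)
open import Data.Nat using (ℕ; zero; suc; _≤_; _<_; _+_; _∸_; _⊔_)
open import Data.Fin using (Fin; toℕ)
import Data.Fin as Fin
open import Data.Fin.Subset using (Subset; _∈_; _∉_; _⊆_; ∣_∣; ⊤; ⊥; ⁅_⁆; _∪_; ∁; inside; outside)
open import Data.Fin.Subset.Properties using (_⊆?_)
open import Data.Fin.Permutation using (Permutation′; _⟨$⟩ʳ_; _⟨$⟩ˡ_)
open import Data.List using (List; []; _∷_; _++_; map; foldr; filterᵇ; deduplicate; length; allFin; upTo)
open import Data.Vec using (Vec; []; _∷_; tabulate; _[_]≔_)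
open import Data.Product using (Σ; ∃; _×_; _,_)
open import Relation.Nullary using (Dec; yes; no; does; ¬_)
open import Relation.Binary.PropositionalEquality using (_≡_; refl; cong; cong₂)
open import Function.Bundles using (_⇔_)

record Matroid (n : ℕ) : Set where
  field
    indep      : Subset n → Bool
    indep-∅    : T (indep ⊥)
    indep-↓    : ∀ {X Y} → Y ⊆ X → T (indep X) → T (indep Y)
    indep-aug  : ∀ {X Y} → T (indep X) → T (indep Y) → ∣ X ∣ < ∣ Y ∣ →
                 ∃ λ e → e ∈ Y × e ∉ X × T (indep (X ∪ ⁅ e ⁆))
open Matroid public

allSubsets : (n : ℕ) → List (Subset n)
allSubsets zero    = [] ∷ []
allSubsets (suc n) = map (outside ∷_) (allSubsets n) ++ map (inside ∷_) (allSubsets n)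

maxList : List ℕ → ℕ
maxList = foldr _⊔_ 0

⊆ᵇ : ∀ {n} → Subset n → Subset n → Bool
⊆ᵇ X Y = does (X ⊆? Y)

rank : ∀ {n} → Matroid n → Subset n → ℕ
rank {n} M X = maxList (map ∣_∣ (filterᵇ (λ Y → ⊆ᵇ Y X ∧ indep M Y) (allSubsets n)))

rankM : ∀ {n} → Matroid n → ℕ
rankM M = rank M ⊤

memᵇ : ∀ {n} → Fin n → Subset n → Bool
memᵇ e X = Data.Vec.lookup X e
  where import Data.Vec

allᵇ : ∀ {A : Set} → (A → Bool) → List A → Bool
allᵇ p = foldr (λ x b → p x ∧ b) true

isBasis : ∀ {n} → Matroid n → Subset n → Bool
isBasis {n} M X = indep M X ∧ allᵇ (λ e → memᵇ e X ∨ not (indep M (X ∪ ⁅ e ⁆))) (allFin n)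

Uniform : ∀ {n} → Matroid n → Set
Uniform {n} M = ∀ (X : Subset n) → T (indep M X) ⇔ (∣ X ∣ ≤ rankM M)

-- connectivity function λ_M(X) = r(X) + r(E∖X) − r(E)  (nonnegative by submodularity)
conn : ∀ {n} → Matroid n → Subset n → ℕ
conn M X = rank M X + rank M (∁ X) ∸ rank M ⊤

-- Total orders on E = Fin n: a permutation π enumerates E as
-- e₁ ≺ e₂ ≺ … ≺ eₙ with e_{j+1} = π ⟨$⟩ʳ j  (j : Fin n, 0-based).

prefix : ∀ {n} → Permutation′ n → ℕ → Subset n
prefix π i = tabulate (λ x → does (Data.Nat._<?_ (toℕ (π ⟨$⟩ˡ x)) i))
  where import Data.Nat

maxConn : ∀ {n} → Matroid n → Permutation′ n → ℕ
maxConn {n} M π = maxList (map (λ i → conn M (prefix π (suc i))) (upTo n))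

IsPathwidth : ∀ {n} → Matroid n → ℕ → Set
IsPathwidth {n} M k = (∃ λ (π : Permutation′ n) → maxConn M π ≡ k)
                    × (∀ (π : Permutation′ n) → k ≤ maxConn M π)

-- A diagram is represented as a term; nodes are
-- identified up to structural equality (hash-consing), so that nodes with
-- the same label and the same 0-/1-successors are merged.

data DD (n : ℕ) : Set where
  ⊥ᵈ ⊤ᵈ : DD n
  node  : Fin n → DD n → DD n → DD n   -- node e ν₀ ν₁

_≟ᵈ_ : ∀ {n} (a b : DD n) → Dec (a ≡ b)
⊥ᵈ ≟ᵈ ⊥ᵈ = yes refl
⊥ᵈ ≟ᵈ ⊤ᵈ = no (λ ())
⊥ᵈ ≟ᵈ node _ _ _ = no (λ ())
⊤ᵈ ≟ᵈ ⊥ᵈ = no (λ ())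
⊤ᵈ ≟ᵈ ⊤ᵈ = yes refl
⊤ᵈ ≟ᵈ node _ _ _ = no (λ ())
node _ _ _ ≟ᵈ ⊥ᵈ = no (λ ())
node _ _ _ ≟ᵈ ⊤ᵈ = no (λ ())
node e a b ≟ᵈ node e' a' b' with e Fin.≟ e' | a ≟ᵈ a' | b ≟ᵈ b'
... | yes refl | yes refl | yes refl = yes refl
... | no ne | _ | _ = no (λ { refl → ne refl })
... | yes _ | no ne | _ = no (λ { refl → ne refl })
... | yes _ | yes _ | no ne = no (λ { refl → ne refl })

-- complete binary decision tree of 𝓢 (given by its characteristic function)
-- along the element list es, X = the set of elements taken with 1-arcs so far
tree : ∀ {n} → (Subset n → Bool) → List (Fin n) → Subset n → DD n
tree S []       X = if S X then ⊤ᵈ else ⊥ᵈ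
tree S (e ∷ es) X = node e (tree S es X) (tree S es (X [ e ]≔ inside))

completeTree : ∀ {n} → Permutation′ n → (Subset n → Bool) → DD n
completeTree {n} π S = tree S (map (π ⟨$⟩ʳ_) (allFin n)) ⊥

reduceWith : ∀ {n} → (DD n → DD n → Bool) → DD n → DD n
reduceWith rem ⊥ᵈ = ⊥ᵈ
reduceWith rem ⊤ᵈ = ⊤ᵈ
reduceWith rem (node e t₀ t₁) with reduceWith rem t₀ | reduceWith rem t₁
... | u₀ | u₁ = if rem u₀ u₁ then u₀ else node e u₀ u₁

bddRem : ∀ {n} → DD n → DD n → Bool
bddRem u₀ u₁ = does (u₀ ≟ᵈ u₁)

zddRem : ∀ {n} → DD n → DD n → Bool
zddRem u₀ u₁ = does (u₁ ≟ᵈ ⊥ᵈ)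

BDD : ∀ {n} → Permutation′ n → (Subset n → Bool) → DD n
BDD π S = reduceWith bddRem (completeTree π S)

ZDD : ∀ {n} → Permutation′ n → (Subset n → Bool) → DD n
ZDD π S = reduceWith zddRem (completeTree π S)

nodes : ∀ {n} → DD n → List (DD n)
nodes ⊥ᵈ = []
nodes ⊤ᵈ = []
nodes (node e a b) = node e a b ∷ (nodes a ++ nodes b)

labelledᵇ : ∀ {n} → Fin n → DD n → Bool
labelledᵇ e (node e' _ _) = does (e Fin.≟ e')
labelledᵇ e _ = false

-- i-th width (i : Fin n, 0-based): number of distinct non-terminal nodes labelled e_{i+1}
widthAt : ∀ {n} → Permutation′ n → DD n → Fin n → ℕ
widthAt π D i = length (filterᵇ (labelledᵇ (π ⟨$⟩ʳ i)) (deduplicate _≟ᵈ_ (nodes D)))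

width : ∀ {n} → Permutation′ n → DD n → ℕ
width {n} π D = maxList (map (widthAt π D) (allFin n))

-- For a uniform matroid of rank r, whether X lies in 𝓘(M) or 𝓑(M) depends only on ∣X∣,
-- so the subtree of the complete decision tree reached after deciding e₁,…,e_i depends
-- only on the number c of 1-arcs taken.  After reduction, every non-terminal node labelled
-- e_{i+1} is also reached with some c in the window [r ∸ (n ∸ i), r ⊓ i]: outside it the
-- subdiagram collapses to a terminal or, for the ZDD of 𝓘(M), coincides with the one at
-- the lower end of the window.  Hence the i-th width is at most (r ⊓ i) ∸ (r ∸ (n ∸ i)) + 1,
-- and (r ⊓ i) ∸ (r ∸ (n ∸ i)) is λ_M of any i-element set, as r_M(X) = ∣X∣ ⊓ r; so it is
-- bounded by the pathwidth.

module Submission where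

open import Defs
open import Data.Bool using (Bool; true; false; T; _∧_; _∨_; not; if_then_else_)
open import Data.Bool.Properties using (∨-zeroʳ; ∨-identityʳ; T-∧)
open import Data.Empty using (⊥-elim) renaming (⊥ to Empty)
open import Data.Fin using (Fin; toℕ)
import Data.Fin as Fin
open import Data.Fin.Permutation using (Permutation′; _⟨$⟩ʳ_; _⟨$⟩ˡ_; inverseˡ; inverseʳ)
open import Data.Fin.Properties using (toℕ-fromℕ<; toℕ-injective; toℕ<n)
open import Data.Fin.Subset using (Subset; ∣_∣; ⊤; ⊥; ⁅_⁆; _∪_; ∁; inside; outside; _⊆_)
open import Data.Fin.Subset.Properties using (_⊆?_; ⊥⊆; out⊆; s⊆s; ∣⊥∣≡0; ∣p∣≤n; ∣∁p∣≡n∸∣p∣; ∪-identityʳ)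
open import Data.List using (List; []; _∷_; map; drop; length; allFin; tabulate; applyUpTo; filterᵇ; deduplicate)
open import Data.List.Membership.Propositional using (_∈_; _∉_)
open import Data.List.Membership.Propositional.Properties
  using (∈-++⁻; ∈-++⁺ˡ; ∈-++⁺ʳ; ∈-map⁺; ∈-filter⁺; ∈-filter⁻; ∈-deduplicate⁻; ∈-applyUpTo⁺; ∈-upTo⁺; ∈-allFin)
open import Data.List.Properties using (length-drop; length-map; length-tabulate; length-applyUpTo; map-tabulate)
open import Data.List.Relation.Unary.All as All using (All; []; _∷_)
open import Data.List.Relation.Unary.Any using (here; there)
open import Data.List.Relation.Unary.Unique.Propositional using (Unique; _∷_)
open import Data.List.Relation.Unary.Unique.Propositional.Properties using (map⁺; allFin⁺; drop⁺; filter⁺; Unique[x∷xs]⇒x∉xs)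
open import Data.List.Relation.Unary.Unique.DecPropositional.Properties using (deduplicate-!)
open import Data.Nat using (ℕ; zero; suc; _≤_; _<_; _+_; _∸_; _⊔_; _⊓_; z≤n; s≤s; _≤?_; _<?_; _≟_; s≤s⁻¹)
open import Data.Nat.Properties
open import Data.Product using (∃; ∃₂; _×_; _,_)
open import Data.Sum using (inj₁; inj₂)
open import Data.Vec using ([]; _∷_; lookup; _[_]≔_)
import Data.Vec.Properties as Vec
open import Function using (id; _∘_)
open import Function.Bundles using (Equivalence)
open import Relation.Nullary using (yes; no; does)
open import Relation.Nullary.Decidable using (T?; dec-true; dec-false)
open import Relation.Binary using (tri<; tri≈; tri>)
open import Relation.Binary.PropositionalEquality

module _ {A : Set} where

  Unique⇒length≤ : ∀ {xs ys : List A} → Unique xs → All (_∈ ys) xs → length xs ≤ length ys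
  Unique⇒length≤ {[]}     _          _              = z≤n
  Unique⇒length≤ {x ∷ xs} {ys} (x∉xs ∷ u) (x∈ys ∷ xs⊆ys) =
    subst (suc (length xs) ≤_) (length-remove ys x∈ys)
      (s≤s (Unique⇒length≤ u (All.zipWith (λ (y∈ys , x≢y) → ∈-remove ys x∈ys y∈ys (x≢y ∘ sym)) (xs⊆ys , x∉xs))))
    where
    remove : ∀ {x} (ys : List A) → x ∈ ys → List A
    remove (_ ∷ ys) (here _)  = ys
    remove (y ∷ ys) (there p) = y ∷ remove ys p

    length-remove : ∀ {x} (ys : List A) (p : x ∈ ys) → suc (length (remove ys p)) ≡ length ys
    length-remove (_ ∷ ys) (here _)  = refl
    length-remove (_ ∷ ys) (there p) = cong suc (length-remove ys p)

    ∈-remove : ∀ {x z} (ys : List A) (p : x ∈ ys) → z ∈ ys → z ≢ x → z ∈ remove ys p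
    ∈-remove (_ ∷ ys) (here refl) (here refl) z≢x = ⊥-elim (z≢x refl)
    ∈-remove (_ ∷ ys) (here _)    (there q)   _   = q
    ∈-remove (_ ∷ ys) (there p)   (here refl) _   = here refl
    ∈-remove (_ ∷ ys) (there p)   (there q)   z≢x = there (∈-remove ys p q z≢x)

  allᵇ-true : ∀ (p : A → Bool) xs → (∀ x → p x ≡ true) → allᵇ p xs ≡ true
  allᵇ-true p []       _      = refl
  allᵇ-true p (x ∷ xs) p≡true rewrite p≡true x = allᵇ-true p xs p≡true

  allᵇ-false : ∀ (p : A → Bool) {x} xs → x ∈ xs → p x ≡ false → allᵇ p xs ≡ false
  allᵇ-false p (_ ∷ xs) (here refl) px≡false rewrite px≡false = refl
  allᵇ-false p (y ∷ xs) (there x∈xs) px≡false with p y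
  ... | true  = allᵇ-false p xs x∈xs px≡false
  ... | false = refl

  maxList-map≤ : ∀ (f : A → ℕ) xs {b} → (∀ x → f x ≤ b) → maxList (map f xs) ≤ b
  maxList-map≤ f []       _   = z≤n
  maxList-map≤ f (x ∷ xs) f≤b = ⊔-lub (f≤b x) (maxList-map≤ f xs f≤b)

  drop-tabulate : ∀ {n} (g : Fin n → A) p {e s} → drop p (tabulate g) ≡ e ∷ s →
                  ∃ λ j → toℕ j ≡ p × e ≡ g j
  drop-tabulate {suc n} g zero    refl = Fin.zero , refl , refl
  drop-tabulate {suc n} g (suc p) eq with drop-tabulate (g ∘ Fin.suc) p eq
  ... | j , j≡p , e≡gj = Fin.suc j , cong suc j≡p , e≡gj

≤-maxList : ∀ {x xs} → x ∈ xs → x ≤ maxList xs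
≤-maxList {xs = y ∷ _}  (here refl) = m≤m⊔n y _
≤-maxList {xs = y ∷ xs} (there p)   = ≤-trans (≤-maxList p) (m≤n⊔m y _)

∣p[x]≔inside∣≡1+∣p∣ : ∀ {n} (p : Subset n) x → lookup p x ≡ outside → ∣ p [ x ]≔ inside ∣ ≡ suc ∣ p ∣
∣p[x]≔inside∣≡1+∣p∣ (outside ∷ p) Fin.zero    _      = refl
∣p[x]≔inside∣≡1+∣p∣ (outside ∷ p) (Fin.suc x) x∉p    = ∣p[x]≔inside∣≡1+∣p∣ p x x∉p
∣p[x]≔inside∣≡1+∣p∣ (inside ∷ p)  (Fin.suc x) x∉p    = cong suc (∣p[x]≔inside∣≡1+∣p∣ p x x∉p)

p∪⁅x⁆≡p[x]≔inside : ∀ {n} (p : Subset n) x → p ∪ ⁅ x ⁆ ≡ p [ x ]≔ inside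
p∪⁅x⁆≡p[x]≔inside (s ∷ p) Fin.zero    = cong₂ _∷_ (∨-zeroʳ s) (∪-identityʳ p)
p∪⁅x⁆≡p[x]≔inside (s ∷ p) (Fin.suc x) = cong₂ _∷_ (∨-identityʳ s) (p∪⁅x⁆≡p[x]≔inside p x)

∣p∪⁅x⁆∣≡1+∣p∣ : ∀ {n} (p : Subset n) x → lookup p x ≡ outside → ∣ p ∪ ⁅ x ⁆ ∣ ≡ suc ∣ p ∣
∣p∪⁅x⁆∣≡1+∣p∣ p x x∉p = trans (cong ∣_∣ (p∪⁅x⁆≡p[x]≔inside p x)) (∣p[x]≔inside∣≡1+∣p∣ p x x∉p)

∣p∣<n⇒∃outside : ∀ {n} (p : Subset n) → ∣ p ∣ < n → ∃ λ x → lookup p x ≡ outside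
∣p∣<n⇒∃outside (outside ∷ p) _         = Fin.zero , refl
∣p∣<n⇒∃outside (inside ∷ p)  (s≤s ∣p∣<n) with ∣p∣<n⇒∃outside p ∣p∣<n
... | x , x∉p = Fin.suc x , x∉p

⊆-of-size : ∀ {n} (p : Subset n) t → t ≤ ∣ p ∣ → ∃ λ q → q ⊆ p × ∣ q ∣ ≡ t
⊆-of-size {n} p zero _ = ⊥ , ⊥⊆ , ∣⊥∣≡0 n
⊆-of-size (outside ∷ p) (suc t) t≤∣p∣ with ⊆-of-size p (suc t) t≤∣p∣
... | q , q⊆p , ∣q∣≡t = outside ∷ q , out⊆ q⊆p , ∣q∣≡t
⊆-of-size (inside ∷ p) (suc t) (s≤s t≤∣p∣) with ⊆-of-size p t t≤∣p∣
... | q , q⊆p , ∣q∣≡t = inside ∷ q , s⊆s q⊆p , cong suc ∣q∣≡t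

∈-allSubsets : ∀ {n} (p : Subset n) → p ∈ allSubsets n
∈-allSubsets []                  = here refl
∈-allSubsets {suc n} (outside ∷ p) = ∈-++⁺ˡ (∈-map⁺ (outside ∷_) (∈-allSubsets p))
∈-allSubsets {suc n} (inside ∷ p)  = ∈-++⁺ʳ (map (outside ∷_) (allSubsets n)) (∈-map⁺ (inside ∷_) (∈-allSubsets p))

module _ {n} (π : Permutation′ n) where

  private
    <-suc-≢ : ∀ v j → v ≢ j → does (v <? j) ≡ does (v <? suc j)
    <-suc-≢ v j v≢j with v <? j
    ... | yes v<j = trans (dec-true (v <? j) v<j) (sym (dec-true (v <? suc j) (m≤n⇒m≤1+n v<j)))
    ... | no  v≮j = trans (dec-false (v <? j) v≮j)
                          (sym (dec-false (v <? suc j) (λ v<1+j → v≮j (≤∧≢⇒< (s≤s⁻¹ v<1+j) v≢j))))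

  prefix-suc : ∀ j (j<n : j < n) → prefix π (suc j) ≡ prefix π j [ π ⟨$⟩ʳ Fin.fromℕ< j<n ]≔ inside
  prefix-suc j j<n = trans (Vec.tabulate-cong pointwise) (Vec.tabulate∘lookup _)
    where
    x = π ⟨$⟩ʳ Fin.fromℕ< j<n
    toℕ[π⁻¹x]≡j : toℕ (π ⟨$⟩ˡ x) ≡ j
    toℕ[π⁻¹x]≡j = trans (cong toℕ (inverseˡ π)) (toℕ-fromℕ< j<n)
    pointwise : ∀ y → does (toℕ (π ⟨$⟩ˡ y) <? suc j) ≡ lookup (prefix π j [ x ]≔ inside) y
    pointwise y with y Fin.≟ x
    ... | yes refl = trans (dec-true (_ <? suc j) (≤-reflexive (cong suc toℕ[π⁻¹x]≡j)))
                           (sym (Vec.lookup∘update x (prefix π j) inside))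
    ... | no y≢x = trans (sym (<-suc-≢ _ j (y≢x ∘ y≡x)))
                         (sym (trans (Vec.lookup∘update′ y≢x (prefix π j) inside)
                                     (Vec.lookup∘tabulate (λ z → does (toℕ (π ⟨$⟩ˡ z) <? j)) y)))
      where
      y≡x : toℕ (π ⟨$⟩ˡ y) ≡ j → y ≡ x
      y≡x eq = trans (sym (inverseʳ π)) (cong (π ⟨$⟩ʳ_) (toℕ-injective (trans eq (sym (toℕ-fromℕ< j<n)))))

  ∣prefix∣ : ∀ j → j ≤ n → ∣ prefix π j ∣ ≡ j
  ∣prefix∣ zero    _   = trans (cong ∣_∣ (trans (Vec.tabulate-cong (λ x → sym (Vec.lookup-replicate x false)))
                                                  (Vec.tabulate∘lookup (⊥ {n}))))
                               (∣⊥∣≡0 n)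
  ∣prefix∣ (suc j) j<n = begin
    ∣ prefix π (suc j) ∣                                    ≡⟨ cong ∣_∣ (prefix-suc j j<n) ⟩
    ∣ prefix π j [ π ⟨$⟩ʳ Fin.fromℕ< j<n ]≔ inside ∣        ≡⟨ ∣p[x]≔inside∣≡1+∣p∣ (prefix π j) _ x∉prefix ⟩
    suc ∣ prefix π j ∣                                      ≡⟨ cong suc (∣prefix∣ j (<⇒≤ j<n)) ⟩
    suc j                                                   ∎
    where
    open ≡-Reasoning
    x∉prefix : lookup (prefix π j) (π ⟨$⟩ʳ Fin.fromℕ< j<n) ≡ outside
    x∉prefix = trans (Vec.lookup∘tabulate (λ y → does (toℕ (π ⟨$⟩ˡ y) <? j)) _)
                     (dec-false (_ <? j) (<-irrefl (trans (cong toℕ (inverseˡ π)) (toℕ-fromℕ< j<n))))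

leaf : ∀ {n} → Bool → DD n
leaf b = if b then ⊤ᵈ else ⊥ᵈ

countTree : ∀ {n} → (ℕ → Bool) → List (Fin n) → ℕ → DD n
countTree h []       j = leaf (h j)
countTree h (e ∷ es) j = node e (countTree h es j) (countTree h es (suc j))

tree≡countTree : ∀ {n} {S : Subset n → Bool} {h : ℕ → Bool} → (∀ X → S X ≡ h ∣ X ∣) →
                 ∀ es X → Unique es → All (λ e → lookup X e ≡ outside) es →
                 tree S es X ≡ countTree h es ∣ X ∣
tree≡countTree S≡h []       X _            _            rewrite S≡h X = refl
tree≡countTree S≡h (e ∷ es) X (e∉es ∷ u) (e∉X ∷ es∉X) =
  cong₂ (node e) (tree≡countTree S≡h es X u es∉X)
    (trans (tree≡countTree S≡h es (X [ e ]≔ inside) u es∉X[e]≔inside)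
           (cong (countTree _ es) (∣p[x]≔inside∣≡1+∣p∣ X e e∉X)))
  where
  es∉X[e]≔inside : All (λ f → lookup (X [ e ]≔ inside) f ≡ outside) es
  es∉X[e]≔inside = All.zipWith (λ (e≢f , f∉X) → trans (Vec.lookup∘update′ (e≢f ∘ sym) X inside) f∉X)
                               (e∉es , es∉X)

constTree : ∀ {n} → Bool → List (Fin n) → DD n
constTree b []       = leaf b
constTree b (e ∷ es) = node e (constTree b es) (constTree b es)

ConstantOn : (ℕ → Bool) → Bool → ℕ → ℕ → Set
ConstantOn h b lo hi = ∀ c → lo ≤ c → c ≤ hi → h c ≡ b

ConstantOn-⊆ : ∀ {h b lo hi lo′ hi′} → lo ≤ lo′ → hi′ ≤ hi → ConstantOn h b lo hi → ConstantOn h b lo′ hi′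
ConstantOn-⊆ lo≤lo′ hi′≤hi h≡b c lo′≤c c≤hi′ = h≡b c (≤-trans lo≤lo′ lo′≤c) (≤-trans c≤hi′ hi′≤hi)

countTree-constant : ∀ {n h b} (es : List (Fin n)) j → ConstantOn h b j (length es + j) →
                     countTree h es j ≡ constTree b es
countTree-constant []       j h≡b = cong leaf (h≡b j ≤-refl ≤-refl)
countTree-constant (e ∷ es) j h≡b =
  cong₂ (node e) (countTree-constant es j (ConstantOn-⊆ ≤-refl (n≤1+n _) h≡b))
                 (countTree-constant es (suc j) (ConstantOn-⊆ (n≤1+n j) (≤-reflexive (+-suc (length es) j)) h≡b))

reduce-constTree : ∀ {n rem} b (es : List (Fin n)) → rem (leaf b) (leaf b) ≡ true →
                   reduceWith rem (constTree b es) ≡ leaf b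
reduce-constTree false []       _     = refl
reduce-constTree true  []       _     = refl
reduce-constTree {rem = rem} b (e ∷ es) merge = begin
  reduceWith rem (constTree b (e ∷ es))
    ≡⟨ cong (λ u → if rem u u then u else node e u u) (reduce-constTree b es merge) ⟩
  (if rem (leaf b) (leaf b) then leaf b else node e (leaf b) (leaf b))
    ≡⟨ cong (if_then leaf b else node e (leaf b) (leaf b)) merge ⟩
  leaf b
    ∎
  where open ≡-Reasoning

reduced : ∀ {n} → (DD n → DD n → Bool) → (ℕ → Bool) → List (Fin n) → ℕ → DD n
reduced rem h es j = reduceWith rem (countTree h es j)

reduced-constant : ∀ {n rem h b} (es : List (Fin n)) j → rem (leaf b) (leaf b) ≡ true →
                   ConstantOn h b j (length es + j) → reduced rem h es j ≡ leaf b
reduced-constant {rem = rem} {b = b} es j merge h≡b =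
  trans (cong (reduceWith rem) (countTree-constant es j h≡b)) (reduce-constTree b es merge)

RootLabel : ∀ {n} → DD n → Fin n → Set
RootLabel (node e _ _) e′ = e ≡ e′
RootLabel _            _  = Empty

leaf-rootless : ∀ {n} {x : DD n} {e} b → RootLabel x e → x ≢ leaf b
leaf-rootless false root refl = root
leaf-rootless true  root refl = root

module _ {n} {rem : DD n → DD n → Bool} {h : ℕ → Bool} where

  rootLabel-∈ : ∀ es j {e} → RootLabel (reduced rem h es j) e → e ∈ es
  rootLabel-∈ []       j root with h j
  ... | true  = ⊥-elim root
  ... | false = ⊥-elim root
  rootLabel-∈ (f ∷ es) j root with rem (reduced rem h es j) (reduced rem h es (suc j))
  ... | true  = there (rootLabel-∈ es j root)
  ... | false = here (sym root)

  root-kept : ∀ {e s} c → e ∉ s → RootLabel (reduced rem h (e ∷ s) c) e →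
              rem (reduced rem h s c) (reduced rem h s (suc c)) ≡ false
  root-kept {e} {s} c e∉s root with rem (reduced rem h s c) (reduced rem h s (suc c))
  ... | true  = ⊥-elim (e∉s (rootLabel-∈ s c root))
  ... | false = refl

  SuffixRoot : List (Fin n) → ℕ → DD n → Set
  SuffixRoot es j x = ∃₂ λ p c → c ≤ p × ∃₂ λ e s → drop p es ≡ e ∷ s × RootLabel x e ×
                        x ≡ reduced rem h (e ∷ s) (j + c)

  SuffixRoot-∷⁰ : ∀ {f es j x} → SuffixRoot es j x → SuffixRoot (f ∷ es) j x
  SuffixRoot-∷⁰ (p , c , c≤p , rest) = suc p , c , m≤n⇒m≤1+n c≤p , rest

  SuffixRoot-∷¹ : ∀ {f es j x} → SuffixRoot es (suc j) x → SuffixRoot (f ∷ es) j x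
  SuffixRoot-∷¹ {j = j} (p , c , c≤p , e , s , drop≡ , root , x≡) =
    suc p , suc c , s≤s c≤p , e , s , drop≡ , root , trans x≡ (cong (reduced rem h (e ∷ s)) (sym (+-suc j c)))

  nodes-reduced : ∀ es j {x} → x ∈ nodes (reduced rem h es j) → SuffixRoot es j x
  nodes-reduced []       j x∈ with h j
  nodes-reduced []       j () | true
  nodes-reduced []       j () | false
  nodes-reduced (f ∷ es) j x∈ with rem (reduced rem h es j) (reduced rem h es (suc j)) in removed
  ... | true = SuffixRoot-∷⁰ (nodes-reduced es j x∈)
  nodes-reduced (f ∷ es) j (here refl) | false =
    0 , 0 , z≤n , f , es , refl , refl ,
    trans (cong (if_then u₀ else node f u₀ u₁) (sym removed)) (cong (reduced rem h (f ∷ es)) (sym (+-identityʳ j)))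
    where
    u₀ = reduced rem h es j
    u₁ = reduced rem h es (suc j)
  nodes-reduced (f ∷ es) j (there x∈) | false with ∈-++⁻ (nodes (reduced rem h es j)) x∈
  ... | inj₁ x∈₀ = SuffixRoot-∷⁰ (nodes-reduced es j x∈₀)
  ... | inj₂ x∈₁ = SuffixRoot-∷¹ (nodes-reduced es (suc j) x∈₁)

atMost : ℕ → ℕ → Bool
atMost r j = does (j ≤? r)

exactly : ℕ → ℕ → Bool
exactly r j = does (j ≟ r)

atMost-above : ∀ {r lo hi} → r < lo → ConstantOn (atMost r) false lo hi
atMost-above {r} r<lo c lo≤c _ = dec-false (c ≤? r) (<⇒≱ (<-≤-trans r<lo lo≤c))

atMost-below : ∀ {r lo hi} → hi ≤ r → ConstantOn (atMost r) true lo hi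
atMost-below {r} hi≤r c _ c≤hi = dec-true (c ≤? r) (≤-trans c≤hi hi≤r)

exactly-above : ∀ {r lo hi} → r < lo → ConstantOn (exactly r) false lo hi
exactly-above {r} r<lo c lo≤c _ = dec-false (c ≟ r) (λ c≡r → <⇒≱ (<-≤-trans r<lo lo≤c) (≤-reflexive c≡r))

exactly-below : ∀ {r lo hi} → hi < r → ConstantOn (exactly r) false lo hi
exactly-below {r} hi<r c _ c≤hi = dec-false (c ≟ r) (λ c≡r → <⇒≱ (≤-<-trans c≤hi hi<r) (≤-reflexive (sym c≡r)))

-- The count c of 1-arcs can be replaced by one in [r ∸ |es|, r] without changing the
-- reduced diagram; the bound by c ⊔ (r ∸ |es|) keeps it at most the level index.
InWindow : ∀ {n} → ℕ → (DD n → DD n → Bool) → (ℕ → Bool) → List (Fin n) → ℕ → Set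
InWindow r rem h es c = ∃ λ c′ → r ∸ length es ≤ c′ × c′ ≤ r × c′ ≤ c ⊔ (r ∸ length es) ×
                                 reduced rem h es c ≡ reduced rem h es c′

Windowed : ∀ {n} → ℕ → (DD n → DD n → Bool) → (ℕ → Bool) → Set
Windowed {n} r rem h = ∀ {e : Fin n} {s} c → e ∉ s → RootLabel (reduced rem h (e ∷ s) c) e →
                       InWindow r rem h (e ∷ s) c

windowed-at : ∀ {n r c} rem h (es : List (Fin n)) → r ∸ length es ≤ c → c ≤ r → InWindow r rem h es c
windowed-at {c = c} _ _ _ lo hi = c , lo , hi , m≤m⊔n c _ , refl

zdd-root⇒child¹≢⊥ : ∀ {n h} {e : Fin n} {s} c → e ∉ s → RootLabel (reduced zddRem h (e ∷ s) c) e →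
                 reduced zddRem h s (suc c) ≢ ⊥ᵈ
zdd-root⇒child¹≢⊥ c e∉s root child¹≡⊥ with trans (sym (dec-true (_ ≟ᵈ ⊥ᵈ) child¹≡⊥)) (root-kept c e∉s root)
... | ()

windowed-bdd-atMost : ∀ {n} r → Windowed {n} r bddRem (atMost r)
windowed-bdd-atMost r {e} {s} c _ root with r <? c | length (e ∷ s) + c ≤? r
... | yes r<c | _ =
  ⊥-elim (leaf-rootless false root (reduced-constant (e ∷ s) c refl (atMost-above r<c)))
... | no _ | yes m+c≤r =
  ⊥-elim (leaf-rootless true root (reduced-constant (e ∷ s) c refl (atMost-below m+c≤r)))
... | no r≮c | no m+c≰r =
  windowed-at bddRem (atMost r) (e ∷ s) (m≤n+o⇒m∸n≤o r (length (e ∷ s)) (<⇒≤ (≰⇒> m+c≰r))) (≮⇒≥ r≮c)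

windowed-bdd-exactly : ∀ {n} r → Windowed {n} r bddRem (exactly r)
windowed-bdd-exactly r {e} {s} c _ root with r <? c | length (e ∷ s) + c <? r
... | yes r<c | _ =
  ⊥-elim (leaf-rootless false root (reduced-constant (e ∷ s) c refl (exactly-above r<c)))
... | no _ | yes m+c<r =
  ⊥-elim (leaf-rootless false root (reduced-constant (e ∷ s) c refl (exactly-below m+c<r)))
... | no r≮c | no m+c≮r =
  windowed-at bddRem (exactly r) (e ∷ s) (m≤n+o⇒m∸n≤o r (length (e ∷ s)) (≮⇒≥ m+c≮r)) (≮⇒≥ r≮c)

windowed-zdd-exactly : ∀ {n} r → Windowed {n} r zddRem (exactly r)
windowed-zdd-exactly r {e} {s} c e∉s root with r <? suc c | length s + suc c <? r
... | yes r<1+c | _ =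
  ⊥-elim (zdd-root⇒child¹≢⊥ c e∉s root (reduced-constant s (suc c) refl (exactly-above r<1+c)))
... | no _ | yes m+c<r =
  ⊥-elim (zdd-root⇒child¹≢⊥ c e∉s root (reduced-constant s (suc c) refl (exactly-below m+c<r)))
... | no r≮1+c | no m+c≮r =
  windowed-at zddRem (exactly r) (e ∷ s)
    (m≤n+o⇒m∸n≤o r (length (e ∷ s)) (subst (r ≤_) (+-suc (length s) c) (≮⇒≥ m+c≮r))) (<⇒≤ (≮⇒≥ r≮1+c))

windowed-zdd-atMost : ∀ {n} r → Windowed {n} r zddRem (atMost r)
windowed-zdd-atMost r {e} {s} c e∉s root with r <? suc c
... | yes r<1+c =
  ⊥-elim (zdd-root⇒child¹≢⊥ c e∉s root (reduced-constant s (suc c) refl (atMost-above r<1+c)))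
... | no r≮1+c with r ∸ length (e ∷ s) ≤? c
...   | yes r∸m≤c = windowed-at zddRem (atMost r) (e ∷ s) r∸m≤c (<⇒≤ (≮⇒≥ r≮1+c))
...   | no  r∸m≰c = r ∸ m , ≤-refl , m∸n≤m r m , m≤n⊔m c _ , all-independent
  where
  m = length (e ∷ s)
  c<r∸m : c < r ∸ m
  c<r∸m = ≰⇒> r∸m≰c
  m≤r : m ≤ r
  m≤r = <⇒≤ (m∸n≢0⇒n<m (λ r∸m≡0 → n≮0 (subst (c <_) r∸m≡0 c<r∸m)))
  m+c≤r : m + c ≤ r
  m+c≤r = ≤-trans (+-monoʳ-≤ m (<⇒≤ c<r∸m)) (≤-reflexive (m+[n∸m]≡n m≤r))
  -- below r ∸ m every completion is independent, so the count no longer matters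
  all-independent : reduced zddRem (atMost r) (e ∷ s) c ≡ reduced zddRem (atMost r) (e ∷ s) (r ∸ m)
  all-independent = cong (reduceWith zddRem)
    (trans (countTree-constant (e ∷ s) c (atMost-below m+c≤r))
           (sym (countTree-constant (e ∷ s) (r ∸ m) (atMost-below (≤-reflexive (m+[n∸m]≡n m≤r))))))

⟨$⟩ʳ-injective : ∀ {n} (π : Permutation′ n) {i j} → π ⟨$⟩ʳ i ≡ π ⟨$⟩ʳ j → i ≡ j
⟨$⟩ʳ-injective π eq = trans (sym (inverseˡ π)) (trans (cong (π ⟨$⟩ˡ_) eq) (inverseˡ π))

order : ∀ {n} → Permutation′ n → List (Fin n)
order {n} π = map (π ⟨$⟩ʳ_) (allFin n)

order-unique : ∀ {n} (π : Permutation′ n) → Unique (order π)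
order-unique {n} π = map⁺ (⟨$⟩ʳ-injective π) (allFin⁺ n)

length-drop-order : ∀ {n} (π : Permutation′ n) i → length (drop i (order π)) ≡ n ∸ i
length-drop-order {n} π i =
  trans (length-drop i (order π)) (cong (_∸ i) (trans (length-map _ (allFin n)) (length-tabulate id)))

order-drop : ∀ {n} (π : Permutation′ n) {p e s} → drop p (order π) ≡ e ∷ s →
             ∃ λ j → toℕ j ≡ p × e ≡ π ⟨$⟩ʳ j
order-drop π {p} drop≡ =
  drop-tabulate (π ⟨$⟩ʳ_) p (trans (cong (drop p) (sym (map-tabulate id (π ⟨$⟩ʳ_)))) drop≡)

labelled-root : ∀ {n} {x : DD n} {e₀ e} → T (labelledᵇ e₀ x) → RootLabel x e → e₀ ≡ e
labelled-root {x = node e′ _ _} {e₀} lab root with e₀ Fin.≟ e′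
... | yes e₀≡e′ = trans e₀≡e′ root

∈-window : ∀ {a b c} → a ≤ c → c ≤ b → c ∈ applyUpTo (a +_) (suc (b ∸ a))
∈-window {a} a≤c c≤b = subst (_∈ _) (m+[n∸m]≡n a≤c) (∈-applyUpTo⁺ (a +_) (s≤s (∸-monoˡ-≤ a c≤b)))

module _ {n} (π : Permutation′ n) {rem : DD n → DD n → Bool} {h : ℕ → Bool} where

  private
    D = reduced rem h (order π) 0

  labelled-node : ∀ i {x} → x ∈ nodes D → T (labelledᵇ (π ⟨$⟩ʳ i) x) →
    ∃₂ λ c s → c ≤ toℕ i × drop (toℕ i) (order π) ≡ (π ⟨$⟩ʳ i) ∷ s ×
               RootLabel x (π ⟨$⟩ʳ i) × x ≡ reduced rem h ((π ⟨$⟩ʳ i) ∷ s) c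
  labelled-node i x∈ lab with nodes-reduced (order π) 0 x∈
  ... | p , c , c≤p , e , s , drop≡ , root , x≡ with labelled-root lab root
  ... | refl with order-drop π {p} drop≡
  ... | j , refl , πi≡πj with ⟨$⟩ʳ-injective π πi≡πj
  ... | refl = c , s , c≤p , drop≡ , root , x≡

  widthAt-reduced≤ : ∀ {r} → r ≤ n → Windowed r rem h → ∀ i →
                     widthAt π D i ≤ suc (r ⊓ toℕ i ∸ (r ∸ (n ∸ toℕ i)))
  widthAt-reduced≤ {r} r≤n windowed i =
    ≤-trans (Unique⇒length≤ (filter⁺ (T? ∘ labelledᵇ (π ⟨$⟩ʳ i)) (deduplicate-! _≟ᵈ_ (nodes D)))
                            (All.tabulate in-window))
            (≤-reflexive (trans (length-map (reduced rem h (drop (toℕ i) (order π))) window)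
                                (length-applyUpTo (a +_) _)))
    where
    a = r ∸ (n ∸ toℕ i)
    b = r ⊓ toℕ i
    window = applyUpTo (a +_) (suc (b ∸ a))
    a≤i : a ≤ toℕ i
    a≤i = m≤n+o⇒m∸n≤o r (n ∸ toℕ i) (≤-trans r≤n (≤-reflexive (sym (m∸n+n≡m (<⇒≤ (toℕ<n i))))))
    in-window : ∀ {x} → x ∈ filterᵇ (labelledᵇ (π ⟨$⟩ʳ i)) (deduplicate _≟ᵈ_ (nodes D)) →
                x ∈ map (reduced rem h (drop (toℕ i) (order π))) window
    in-window x∈ with ∈-filter⁻ (T? ∘ labelledᵇ (π ⟨$⟩ʳ i)) {xs = deduplicate _≟ᵈ_ (nodes D)} x∈
    ... | x∈D , lab with labelled-node i (∈-deduplicate⁻ _≟ᵈ_ (nodes D) x∈D) lab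
    ... | c , s , c≤i , drop≡ , root , refl
          with windowed c (Unique[x∷xs]⇒x∉xs (subst Unique drop≡ (drop⁺ (toℕ i) (order-unique π)))) root
    ... | c′ , lo≤c′ , c′≤r , c′≤c⊔lo , same =
      subst (_∈ _) (trans (cong (λ es → reduced rem h es c′) drop≡) (sym same))
            (∈-map⁺ (reduced rem h (drop (toℕ i) (order π))) (∈-window a≤c′ c′≤b))
      where
      m≡ : length ((π ⟨$⟩ʳ i) ∷ s) ≡ n ∸ toℕ i
      m≡ = trans (cong length (sym drop≡)) (length-drop-order π (toℕ i))
      a≤c′ : a ≤ c′
      a≤c′ = subst (λ m → r ∸ m ≤ c′) m≡ lo≤c′
      c′≤b : c′ ≤ b
      c′≤b = ⊓-glb c′≤r (≤-trans c′≤c⊔lo (⊔-lub c≤i (subst (λ m → r ∸ m ≤ toℕ i) (sym m≡) a≤i)))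

m∸[o∸n]≡m+[n⊓o]∸o : ∀ m n o → m ∸ (o ∸ n) ≡ m + (n ⊓ o) ∸ o
m∸[o∸n]≡m+[n⊓o]∸o m n o with n ≤? o
... | yes n≤o = begin
  m ∸ (o ∸ n)            ≡⟨ [m+n]∸[m+o]≡n∸o n m (o ∸ n) ⟨
  n + m ∸ (n + (o ∸ n))  ≡⟨ cong₂ _∸_ (+-comm n m) (m+[n∸m]≡n n≤o) ⟩
  m + n ∸ o              ≡⟨ cong (λ k → m + k ∸ o) (m≤n⇒m⊓n≡m n≤o) ⟨
  m + (n ⊓ o) ∸ o        ∎
  where open ≡-Reasoning
... | no n≰o = begin
  m ∸ (o ∸ n)            ≡⟨ cong (m ∸_) (m≤n⇒m∸n≡0 o≤n) ⟩
  m                      ≡⟨ m+n∸n≡m m o ⟨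
  m + o ∸ o              ≡⟨ cong (λ k → m + k ∸ o) (m≥n⇒m⊓n≡n o≤n) ⟨
  m + (n ⊓ o) ∸ o        ∎
  where
  open ≡-Reasoning
  o≤n = <⇒≤ (≰⇒> n≰o)

rankM≤n : ∀ {n} (M : Matroid n) → rankM M ≤ n
rankM≤n {n} M = maxList-map≤ ∣_∣ (filterᵇ (λ Y → ⊆ᵇ Y ⊤ ∧ indep M Y) (allSubsets n)) ∣p∣≤n

module _ {n} (M : Matroid n) (uniform : Uniform M) where

  private
    r = rankM M
    saturatedᵇ : Subset n → Fin n → Bool
    saturatedᵇ X x = memᵇ x X ∨ not (indep M (X ∪ ⁅ x ⁆))

  indep≡atMost : ∀ X → indep M X ≡ atMost r ∣ X ∣
  indep≡atMost X with indep M X in indep-X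
  ... | true  = sym (dec-true (∣ X ∣ ≤? r) (Equivalence.to (uniform X) (subst T (sym indep-X) _)))
  ... | false = sym (dec-false (∣ X ∣ ≤? r) (λ ∣X∣≤r → subst T indep-X (Equivalence.from (uniform X) ∣X∣≤r)))

  indep-∪⁅x⁆ : ∀ X x → lookup X x ≡ outside → indep M (X ∪ ⁅ x ⁆) ≡ atMost r (suc ∣ X ∣)
  indep-∪⁅x⁆ X x x∉X = trans (indep≡atMost (X ∪ ⁅ x ⁆)) (cong (atMost r) (∣p∪⁅x⁆∣≡1+∣p∣ X x x∉X))

  isBasis≡exactly : ∀ X → isBasis M X ≡ exactly r ∣ X ∣
  isBasis≡exactly X with <-cmp ∣ X ∣ r
  ... | tri> _ _ r<∣X∣ =
    trans (cong (_∧ allᵇ (saturatedᵇ X) (allFin n))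
                (trans (indep≡atMost X) (dec-false (∣ X ∣ ≤? r) (<⇒≱ r<∣X∣))))
          (sym (dec-false (∣ X ∣ ≟ r) (>⇒≢ r<∣X∣)))
  ... | tri≈ _ ∣X∣≡r _ =
    trans (cong₂ _∧_ (trans (indep≡atMost X) (dec-true (∣ X ∣ ≤? r) (≤-reflexive ∣X∣≡r)))
                     (allᵇ-true (saturatedᵇ X) (allFin n) saturated))
          (sym (dec-true (∣ X ∣ ≟ r) ∣X∣≡r))
    where
    saturated : ∀ x → saturatedᵇ X x ≡ true
    saturated x with lookup X x in x∈?X
    ... | true  = refl
    ... | false = cong not (trans (indep-∪⁅x⁆ X x x∈?X)
                                  (dec-false (suc ∣ X ∣ ≤? r) (<⇒≱ (≤-reflexive (cong suc (sym ∣X∣≡r))))))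
  ... | tri< ∣X∣<r _ _ with ∣p∣<n⇒∃outside X (<-≤-trans ∣X∣<r (rankM≤n M))
  ...   | x , x∉X =
    trans (cong₂ _∧_ (trans (indep≡atMost X) (dec-true (∣ X ∣ ≤? r) (<⇒≤ ∣X∣<r)))
                     (allᵇ-false (saturatedᵇ X) (allFin n) (∈-allFin x) unsaturated))
          (sym (dec-false (∣ X ∣ ≟ r) (<⇒≢ ∣X∣<r)))
    where
    unsaturated : saturatedᵇ X x ≡ false
    unsaturated = cong₂ _∨_ x∉X (cong not (trans (indep-∪⁅x⁆ X x x∉X) (dec-true (suc ∣ X ∣ ≤? r) ∣X∣<r)))

  ⊓-≤-rank : ∀ X → ∣ X ∣ ⊓ r ≤ rank M X
  ⊓-≤-rank X with ⊆-of-size X (∣ X ∣ ⊓ r) (m⊓n≤m _ _)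
  ... | Y , Y⊆X , ∣Y∣≡ = subst (_≤ rank M X) ∣Y∣≡
    (≤-maxList (∈-map⁺ ∣_∣ (∈-filter⁺ (λ Z → T? (⊆ᵇ Z X ∧ indep M Z)) (∈-allSubsets Y) Y-candidate)))
    where
    Y-indep : T (indep M Y)
    Y-indep = Equivalence.from (uniform Y) (subst (_≤ r) (sym ∣Y∣≡) (m⊓n≤n _ _))
    Y-candidate : T (⊆ᵇ Y X ∧ indep M Y)
    Y-candidate = Equivalence.from T-∧ (subst T (sym (dec-true (Y ⊆? X) Y⊆X)) _ , Y-indep)

  conn-≥ : ∀ X → ∣ X ∣ ⊓ r + (n ∸ ∣ X ∣) ⊓ r ∸ r ≤ conn M X
  conn-≥ X = ∸-monoˡ-≤ r (+-mono-≤ (⊓-≤-rank X)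
    (subst (λ m → m ⊓ r ≤ rank M (∁ X)) (∣∁p∣≡n∸∣p∣ X) (⊓-≤-rank (∁ X))))

  window≤pathwidth : ∀ {k} → IsPathwidth M k → ∀ i → i < n → r ⊓ i ∸ (r ∸ (n ∸ i)) ≤ k
  window≤pathwidth _ zero _ = ≤-trans (≤-reflexive (trans (cong (_∸ (r ∸ n)) (⊓-zeroʳ r)) (0∸n≡0 (r ∸ n)))) z≤n
  window≤pathwidth {k} ((π , maxConn≡k) , _) (suc i) 1+i<n = begin
    r ⊓ suc i ∸ (r ∸ (n ∸ suc i))        ≡⟨ m∸[o∸n]≡m+[n⊓o]∸o (r ⊓ suc i) (n ∸ suc i) r ⟩
    r ⊓ suc i + (n ∸ suc i) ⊓ r ∸ r      ≡⟨ cong (λ m → m + (n ∸ suc i) ⊓ r ∸ r) (⊓-comm r (suc i)) ⟩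
    suc i ⊓ r + (n ∸ suc i) ⊓ r ∸ r      ≡⟨ cong (λ m → m ⊓ r + (n ∸ m) ⊓ r ∸ r) ∣P∣≡1+i ⟨
    ∣ P ∣ ⊓ r + (n ∸ ∣ P ∣) ⊓ r ∸ r      ≤⟨ conn-≥ P ⟩
    conn M P                             ≤⟨ ≤-maxList (∈-map⁺ conn-prefix (∈-upTo⁺ (<⇒≤ 1+i<n))) ⟩
    maxConn M π                          ≡⟨ maxConn≡k ⟩
    k                                    ∎
    where
    open ≤-Reasoning
    P = prefix π (suc i)
    conn-prefix = λ j → conn M (prefix π (suc j))
    ∣P∣≡1+i : ∣ P ∣ ≡ suc i
    ∣P∣≡1+i = ∣prefix∣ π (suc i) (<⇒≤ 1+i<n)

completeTree≡countTree : ∀ {n} (π : Permutation′ n) {S h} → (∀ X → S X ≡ h ∣ X ∣) →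
                         completeTree π S ≡ countTree h (order π) 0
completeTree≡countTree {n} π {h = h} S≡h =
  trans (tree≡countTree S≡h (order π) ⊥ (order-unique π)
                        (All.tabulate (λ {x} _ → Vec.lookup-replicate x outside)))
        (cong (countTree h (order π)) (∣⊥∣≡0 n))

width-symmetric≤ : ∀ {n} (π : Permutation′ n) {S : Subset n → Bool} {rem h r b} →
                   (∀ X → S X ≡ h ∣ X ∣) → r ≤ n → Windowed r rem h →
                   (∀ i → i < n → r ⊓ i ∸ (r ∸ (n ∸ i)) ≤ b) →
                   width π (reduceWith rem (completeTree π S)) ≤ suc b
width-symmetric≤ {n} π {rem = rem} {h} {b = b} S≡h r≤n windowed window≤b =
  subst (λ D → width π (reduceWith rem D) ≤ suc b) (sym (completeTree≡countTree π S≡h))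
    (maxList-map≤ (widthAt π (reduced rem h (order π) 0)) (allFin n)
      (λ i → ≤-trans (widthAt-reduced≤ π r≤n windowed i) (s≤s (window≤b (toℕ i) (toℕ<n i)))))

theorem4p11 : ∀ {n : ℕ} (M : Matroid n) → Uniform M →
    ∀ (π : Permutation′ n) (k : ℕ) → IsPathwidth M k →
      (width π (BDD π (indep M)) ≤ suc k)
      × (width π (BDD π (isBasis M)) ≤ suc k)
      × (width π (ZDD π (indep M)) ≤ suc k)
      × (width π (ZDD π (isBasis M)) ≤ suc k)
theorem4p11 M uniform π k pw =
    width≤ (indep≡atMost M uniform)     (windowed-bdd-atMost r)
  , width≤ (isBasis≡exactly M uniform)  (windowed-bdd-exactly r)
  , width≤ (indep≡atMost M uniform)     (windowed-zdd-atMost r)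
  , width≤ (isBasis≡exactly M uniform)  (windowed-zdd-exactly r)
  where
  r = rankM M
  width≤ : ∀ {S h rem} → (∀ X → S X ≡ h ∣ X ∣) → Windowed r rem h →
           width π (reduceWith rem (completeTree π S)) ≤ suc k
  width≤ S≡h windowed = width-symmetric≤ π S≡h (rankM≤n M) windowed (window≤pathwidth M uniform pw)
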